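{- If $n$ is a positive integer and $r$ and $s$ are any integers, then \[ 5\sum_{k = 0}^{\lfloor n/2 \rfloor } \binom n{2k}F_{3k + r} F_{3k + s} = 2^{n - 1} \big( L_{2n + r + s} + ( - 1)^n L_{n + r + s} \big) - ( - 1)^s \sqrt{2^n} \cos \Big(\frac{n\pi}{4}\Big) L_{r - s}, \] \[ \sum_{k = 0}^{\lfloor n/2 \rfloor } \binom n{2k}L_{3k + r} F_{3k + s} = 2^{n - 1} \bigl( F_{2n + r + s} + ( - 1)^n F_{n + r + s} \bigr) - ( - 1)^s \sqrt{2^n} \cos\Big(\frac{n\pi}{4}\Big)F_{r - s}, \] \[ \sum_{k = 0}^{\lfloor n/2 \rfloor } \binom n{2k}L_{3k + r} L_{3k + s} = 2^{n - 1} \bigl( L_{2n + r + s} + ( - 1)^n L_{n + r + s} \bigr) + ( - 1)^s \sqrt{2^n} \cos\Big(\frac{n\pi}{4}\Big)L_{r - s}. \]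
   Context: The Fibonacci numbers $F_j$ and Lucas numbers $L_j$ are defined for all integers $j$ by $F_0=0$, $F_1=1$, $L_0=2$, $L_1=1$, $F_j=F_{j-1}+F_{j-2}$, $L_j=L_{j-1}+L_{j-2}$, with $F_{ -j}=(-1)^{j-1}F_j$ and $L_{ -j}=(-1)^jL_j$. -}

module Defs where

open import Data.Nat as ℕ using (ℕ; zero; suc)
open import Data.Nat.Combinatorics using (_C_)
open import Data.Integer as ℤ using (ℤ; +_; -[1+_]; _-_; -_)
open import Data.List using (List; map; upTo)
open import Data.Product using (_×_; _,_; proj₁)

sgn : ℕ → ℤ
sgn zero = + 1
sgn (suc n) = - sgn n

fibℕ : ℕ → ℕ
fibℕ zero = 0
fibℕ (suc zero) = 1
fibℕ (suc (suc n)) = fibℕ (suc n) ℕ.+ fibℕ n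

lucℕ : ℕ → ℕ
lucℕ zero = 2
lucℕ (suc zero) = 1
lucℕ (suc (suc n)) = lucℕ (suc n) ℕ.+ lucℕ n

-- Extension to all integers: F_{-j} = (-1)^{j-1} F_j, L_{-j} = (-1)^j L_j
F : ℤ → ℤ
F (+ n) = + fibℕ n
F (-[1+ n ]) = sgn n ℤ.* + fibℕ (suc n)

L : ℤ → ℤ
L (+ n) = + lucℕ n
L (-[1+ n ]) = sgn (suc n) ℤ.* + lucℕ (suc n)

-- (1+i)^n as a Gaussian integer (real part, imaginary part)
onePlusIPow : ℕ → ℤ × ℤ
onePlusIPow zero = + 1 , + 0
onePlusIPow (suc n) with onePlusIPow n
... | a , b = a - b , a ℤ.+ b

-- sqrt(2^n) * cos(n π / 4) = Re((1+i)^n), an integer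
sqrt2ⁿcos : ℕ → ℤ
sqrt2ⁿcos n = proj₁ (onePlusIPow n)

Σ< : ℕ → (ℕ → ℤ) → ℤ
Σ< m f = Data.List.foldr ℤ._+_ (+ 0) (map f (upTo m))

-- (-1)^s for an integer s (depends only on parity; ∣ s ∣ has the same parity)
sgn' : ℤ → ℤ
sgn' s = sgn ℤ.∣ s ∣

{-# OPTIONS --safe #-}
-- The product formulas 5 F_a F_b = L_(a+b) - (-1)^b L_(a-b), L_a F_b = F_(a+b) - (-1)^b F_(a-b)
-- and L_a L_b = L_(a+b) + (-1)^b L_(a-b) hold because both sides are Fibonacci sequences in a
-- and in b, so it suffices to compare them at a, b ∈ {0, 1}.  With a = 3k + r and b = 3k + s
-- the sum becomes Σ_k C(n,2k) G_(6k+r+s) ± (-1)^s G_(r-s) Σ_k (-1)^k C(n,2k), and the last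
-- sum is Re (1 + i)^n.  For the first sum let T shift a Fibonacci sequence G: then 1 + T³ = 2T²
-- and 1 - T³ = -2T, so Σ_j C(n,j) G_(3j+x) = 2^n G_(2n+x) and Σ_j (-1)^j C(n,j) G_(3j+x) =
-- (-2)^n G_(n+x); the terms with j even make up half their sum.
module Submission where

open import Defs
open import Data.Nat as ℕ using (ℕ; NonZero; _/_; _∸_)
open import Data.Nat.Combinatorics using (_C_)
open import Data.Integer as ℤ using (ℤ; +_; _+_; _*_; _-_)
open import Data.Product using (_×_)
open import Relation.Binary.PropositionalEquality using (_≡_)

open import Data.Integer using (-[1+_]; -_; -1ℤ; 1ℤ) renaming (suc to sucℤ)
import Data.Integer.Properties as ℤP
open import Algebra.Properties.CommutativeSemigroup ℤP.+-commutativeSemigroup using (interchange)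
open import Data.Integer.Tactic.RingSolver using (solve-∀)
open import Data.List using (List; []; _∷_; [_]; _++_; _∷ʳ_; foldr; map; upTo)
open import Data.List.Properties using (map-applyUpTo; map-upTo; upTo-∷ʳ)
open import Data.Nat using (zero; suc; _<_)
open import Data.Nat.Combinatorics using (nCk+nC[k+1]≡[n+1]C[k+1]; k>n⇒nCk≡0)
open import Data.Nat.DivMod using (m≡m%n+[m/n]*n; m%n<n)
import Data.Nat.Properties as ℕP
open import Data.Product using (_,_; proj₁; proj₂)
open import Function using (_∘_)
open import Relation.Binary.PropositionalEquality using (refl; sym; trans; cong; cong₂; subst; module ≡-Reasoning)
open ≡-Reasoning

sumOver : List ℕ → (ℕ → ℤ) → ℤ
sumOver ks f = foldr _+_ (+ 0) (map f ks)

sumOver-cong : ∀ ks {f g : ℕ → ℤ} → (∀ k → f k ≡ g k) → sumOver ks f ≡ sumOver ks g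
sumOver-cong []       f≗g = refl
sumOver-cong (k ∷ ks) f≗g = cong₂ _+_ (f≗g k) (sumOver-cong ks f≗g)

sumOver-zero : ∀ ks {f : ℕ → ℤ} → (∀ k → f k ≡ + 0) → sumOver ks f ≡ + 0
sumOver-zero []       f≗0 = refl
sumOver-zero (k ∷ ks) f≗0 = cong₂ _+_ (f≗0 k) (sumOver-zero ks f≗0)

sumOver-+ : ∀ ks (f g : ℕ → ℤ) → sumOver ks (λ k → f k + g k) ≡ sumOver ks f + sumOver ks g
sumOver-+ []       f g = refl
sumOver-+ (k ∷ ks) f g = trans (cong (_+_ (f k + g k)) (sumOver-+ ks f g)) (interchange (f k) (g k) _ _)

sumOver-*ˡ : ∀ ks c (f : ℕ → ℤ) → sumOver ks (λ k → c * f k) ≡ c * sumOver ks f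
sumOver-*ˡ []       c f = sym (ℤP.*-zeroʳ c)
sumOver-*ˡ (k ∷ ks) c f = trans (cong (_+_ (c * f k)) (sumOver-*ˡ ks c f)) (sym (ℤP.*-distribˡ-+ c (f k) _))

sumOver-neg : ∀ ks (f : ℕ → ℤ) → sumOver ks (λ k → - f k) ≡ - sumOver ks f
sumOver-neg []       f = refl
sumOver-neg (k ∷ ks) f = trans (cong (_+_ (- f k)) (sumOver-neg ks f)) (sym (ℤP.neg-distrib-+ (f k) _))

sumOver-++ : ∀ ks ls (f : ℕ → ℤ) → sumOver (ks ++ ls) f ≡ sumOver ks f + sumOver ls f
sumOver-++ []       ls f = sym (ℤP.+-identityˡ _)
sumOver-++ (k ∷ ks) ls f = trans (cong (_+_ (f k)) (sumOver-++ ks ls f)) (sym (ℤP.+-assoc (f k) _ _))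

Σ<-sucˡ : ∀ m (f : ℕ → ℤ) → Σ< (suc m) f ≡ f 0 + Σ< m (f ∘ suc)
Σ<-sucˡ m f = cong (λ fs → f 0 + foldr _+_ (+ 0) fs)
  (trans (map-applyUpTo suc f m) (sym (map-upTo (f ∘ suc) m)))

Σ<-sucʳ : ∀ m (f : ℕ → ℤ) → Σ< (suc m) f ≡ Σ< m f + f m
Σ<-sucʳ m f = begin
  Σ< (suc m) f              ≡⟨ cong (λ ks → sumOver ks f) (upTo-∷ʳ m) ⟨
  sumOver (upTo m ∷ʳ m) f   ≡⟨ sumOver-++ (upTo m) [ m ] f ⟩
  Σ< m f + (f m + + 0)      ≡⟨ cong (_+_ (Σ< m f)) (ℤP.+-identityʳ (f m)) ⟩
  Σ< m f + f m              ∎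

evenBinomialSum oddBinomialSum : ℕ → ℕ → (ℕ → ℤ) → ℤ
evenBinomialSum N n h = Σ< N (λ k → + (n C (2 ℕ.* k)) * h k)
oddBinomialSum  N n h = Σ< N (λ k → + (n C suc (2 ℕ.* k)) * h k)

pascal : ∀ n k x → + (suc n C suc k) * x ≡ + (n C k) * x + + (n C suc k) * x
pascal n k x = begin
  + (suc n C suc k) * x              ≡⟨ cong (λ m → + m * x) (nCk+nC[k+1]≡[n+1]C[k+1] n k) ⟨
  + (n C k ℕ.+ n C suc k) * x        ≡⟨ ℤP.*-distribʳ-+ x (+ (n C k)) (+ (n C suc k)) ⟩
  + (n C k) * x + + (n C suc k) * x  ∎

evenBinomialSum-zero : ∀ M h → evenBinomialSum (suc M) 0 h ≡ h 0
evenBinomialSum-zero M h = begin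
  evenBinomialSum (suc M) 0 h
    ≡⟨ Σ<-sucˡ M (λ k → + (0 C (2 ℕ.* k)) * h k) ⟩
  + 1 * h 0 + Σ< M (λ k → + (0 C (2 ℕ.* suc k)) * h (suc k))
    ≡⟨ cong₂ _+_ (ℤP.*-identityˡ (h 0)) (sumOver-zero (upTo M) (λ _ → refl)) ⟩
  h 0 + + 0
    ≡⟨ ℤP.+-identityʳ (h 0) ⟩
  h 0
    ∎

oddBinomialSum-zero : ∀ N h → oddBinomialSum N 0 h ≡ + 0
oddBinomialSum-zero N h = sumOver-zero (upTo N) (λ _ → refl)

oddBinomialSum-suc : ∀ {N n} h → oddBinomialSum N (suc n) h ≡ evenBinomialSum N n h + oddBinomialSum N n h
oddBinomialSum-suc {N} {n} h =
  trans (sumOver-cong (upTo N) (λ k → pascal n (2 ℕ.* k) (h k))) (sumOver-+ (upTo N) _ _)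

oddBinomialSum-truncate : ∀ {M n} h → n < suc (2 ℕ.* M) → oddBinomialSum (suc M) n h ≡ oddBinomialSum M n h
oddBinomialSum-truncate {M} {n} h n<1+2M = begin
  oddBinomialSum (suc M) n h
    ≡⟨ Σ<-sucʳ M (λ k → + (n C suc (2 ℕ.* k)) * h k) ⟩
  oddBinomialSum M n h + + (n C suc (2 ℕ.* M)) * h M
    ≡⟨ cong (λ c → oddBinomialSum M n h + + c * h M) (k>n⇒nCk≡0 n<1+2M) ⟩
  oddBinomialSum M n h + + 0
    ≡⟨ ℤP.+-identityʳ _ ⟩
  oddBinomialSum M n h
    ∎

evenBinomialSum-suc : ∀ {N n} h → suc n < 2 ℕ.* N →
  evenBinomialSum N (suc n) h ≡ evenBinomialSum N n h + oddBinomialSum N n (h ∘ suc)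
evenBinomialSum-suc {zero}      h _      = refl
evenBinomialSum-suc {suc M} {n} h 1+n<2N = begin
  evenBinomialSum (suc M) (suc n) h
    ≡⟨ Σ<-sucˡ M (λ k → + (suc n C (2 ℕ.* k)) * h k) ⟩
  + 1 * h 0 + Σ< M (λ k → + (suc n C (2 ℕ.* suc k)) * h (suc k))
    ≡⟨ cong (_+_ (+ 1 * h 0)) (trans (sumOver-cong (upTo M) split) (sumOver-+ (upTo M) _ _)) ⟩
  + 1 * h 0 + (oddBinomialSum M n (h ∘ suc) + Σ< M (λ k → + (n C (2 ℕ.* suc k)) * h (suc k)))
    ≡⟨ rotate (+ 1 * h 0) _ _ ⟩
  (+ 1 * h 0 + Σ< M (λ k → + (n C (2 ℕ.* suc k)) * h (suc k))) + oddBinomialSum M n (h ∘ suc)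
    ≡⟨ cong₂ _+_ (Σ<-sucˡ M (λ k → + (n C (2 ℕ.* k)) * h k))
                 (oddBinomialSum-truncate {M} (h ∘ suc) n<1+2M) ⟨
  evenBinomialSum (suc M) n h + oddBinomialSum (suc M) n (h ∘ suc)
    ∎
  where
  rotate : ∀ a b c → a + (b + c) ≡ (a + c) + b
  rotate = solve-∀
  n<1+2M : n < suc (2 ℕ.* M)
  n<1+2M = ℕP.≤-pred (subst (suc n <_) (ℕP.*-suc 2 M) 1+n<2N)
  split : ∀ k → + (suc n C (2 ℕ.* suc k)) * h (suc k)
              ≡ + (n C suc (2 ℕ.* k)) * h (suc k) + + (n C (2 ℕ.* suc k)) * h (suc k)
  split k = begin
    + (suc n C (2 ℕ.* suc k)) * h (suc k)
      ≡⟨ cong (λ j → + (suc n C j) * h (suc k)) (ℕP.*-suc 2 k) ⟩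
    + (suc n C suc (suc (2 ℕ.* k))) * h (suc k)
      ≡⟨ pascal n (suc (2 ℕ.* k)) (h (suc k)) ⟩
    + (n C suc (2 ℕ.* k)) * h (suc k) + + (n C suc (suc (2 ℕ.* k))) * h (suc k)
      ≡⟨ cong (λ j → + (n C suc (2 ℕ.* k)) * h (suc k) + + (n C j) * h (suc k)) (ℕP.*-suc 2 k) ⟨
    + (n C suc (2 ℕ.* k)) * h (suc k) + + (n C (2 ℕ.* suc k)) * h (suc k)
      ∎

binomialSums-sgn : ∀ {N} n → n < 2 ℕ.* N → (evenBinomialSum N n sgn , oddBinomialSum N n sgn) ≡ onePlusIPow n
binomialSums-sgn {suc M} zero    _      = cong₂ _,_ (evenBinomialSum-zero M sgn) (oddBinomialSum-zero (suc M) sgn)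
binomialSums-sgn {N}     (suc n) 1+n<2N = begin
  (evenBinomialSum N (suc n) sgn , oddBinomialSum N (suc n) sgn)
    ≡⟨ cong₂ _,_ (evenBinomialSum-suc {N} {n} sgn 1+n<2N) (oddBinomialSum-suc {N} {n} sgn) ⟩
  (E + oddBinomialSum N n (sgn ∘ suc) , E + O)
    ≡⟨ cong (λ o → E + o , E + O) oddBinomialSum-sgn∘suc ⟩
  (E - O , E + O)
    ≡⟨ cong (λ p → proj₁ p - proj₂ p , proj₁ p + proj₂ p) (binomialSums-sgn {N} n (ℕP.<⇒≤ 1+n<2N)) ⟩
  onePlusIPow (suc n)
    ∎
  where
  E = evenBinomialSum N n sgn
  O = oddBinomialSum N n sgn
  oddBinomialSum-sgn∘suc : oddBinomialSum N n (sgn ∘ suc) ≡ - O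
  oddBinomialSum-sgn∘suc = trans
    (sumOver-cong (upTo N) (λ k → sym (ℤP.neg-distribʳ-* (+ (n C suc (2 ℕ.* k))) (sgn k))))
    (sumOver-neg (upTo N) (λ k → + (n C suc (2 ℕ.* k)) * sgn k))

sgn'-suc : ∀ b → sgn' (sucℤ b) ≡ - sgn' b
sgn'-suc (+ n)          = refl
sgn'-suc -[1+ 0 ]       = refl
sgn'-suc -[1+ suc n ]   = sym (ℤP.neg-involutive (sgn (suc n)))

sgn'-suc-suc : ∀ b → sgn' (sucℤ (sucℤ b)) ≡ sgn' b
sgn'-suc-suc b = trans (trans (sgn'-suc (sucℤ b)) (cong -_ (sgn'-suc b))) (ℤP.neg-involutive (sgn' b))

sgn'-+ : ∀ m b → sgn' (+ m + b) ≡ sgn m * sgn' b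
sgn'-+ zero    b = trans (cong sgn' (ℤP.+-identityˡ b)) (sym (ℤP.*-identityˡ (sgn' b)))
sgn'-+ (suc m) b = begin
  sgn' (+ suc m + b)       ≡⟨ cong sgn' (ℤP.+-assoc (+ 1) (+ m) b) ⟩
  sgn' (sucℤ (+ m + b))    ≡⟨ sgn'-suc (+ m + b) ⟩
  - sgn' (+ m + b)         ≡⟨ cong -_ (sgn'-+ m b) ⟩
  - (sgn m * sgn' b)       ≡⟨ ℤP.neg-distribˡ-* (sgn m) (sgn' b) ⟩
  - sgn m * sgn' b         ∎

sgn-3* : ∀ k → sgn (3 ℕ.* k) ≡ sgn k
sgn-3* zero    = refl
sgn-3* (suc k) = begin
  sgn (3 ℕ.* suc k)      ≡⟨ cong sgn (ℕP.*-suc 3 k) ⟩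
  - - - sgn (3 ℕ.* k)    ≡⟨ cong -_ (ℤP.neg-involutive _) ⟩
  - sgn (3 ℕ.* k)        ≡⟨ cong -_ (sgn-3* k) ⟩
  - sgn k                ∎

record IsFibonacci (G : ℤ → ℤ) : Set where
  field
    recurrence : ∀ m → G (sucℤ (sucℤ m)) ≡ G (sucℤ m) + G m

  recurrence⁻ : ∀ m → G m ≡ G (sucℤ (sucℤ m)) - G (sucℤ m)
  recurrence⁻ m = trans (uncancel (G (sucℤ m)) (G m)) (cong (_- G (sucℤ m)) (sym (recurrence m)))
    where
    uncancel : ∀ a b → b ≡ (a + b) - a
    uncancel = solve-∀

  recurrence³ : ∀ m → G (sucℤ (sucℤ (sucℤ m))) ≡ (G (sucℤ m) + G m) + G (sucℤ m)
  recurrence³ m = trans (recurrence (sucℤ m)) (cong (_+ G (sucℤ m)) (recurrence m))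

  threeApart-sum : ∀ m → G m + G (sucℤ (sucℤ (sucℤ m))) ≡ + 2 * G (sucℤ (sucℤ m))
  threeApart-sum m = begin
    G m + G (sucℤ (sucℤ (sucℤ m)))            ≡⟨ cong (_+_ (G m)) (recurrence³ m) ⟩
    G m + ((G (sucℤ m) + G m) + G (sucℤ m))   ≡⟨ collect (G m) (G (sucℤ m)) ⟩
    + 2 * (G (sucℤ m) + G m)                  ≡⟨ cong (+ 2 *_) (recurrence m) ⟨
    + 2 * G (sucℤ (sucℤ m))                   ∎
    where
    collect : ∀ a b → a + ((b + a) + b) ≡ + 2 * (b + a)
    collect = solve-∀

  threeApart-difference : ∀ m → G (sucℤ (sucℤ (sucℤ m))) - G m ≡ + 2 * G (sucℤ m)
  threeApart-difference m = trans (cong (_- G m) (recurrence³ m)) (collect (G m) (G (sucℤ m)))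
    where
    collect : ∀ a b → ((b + a) + b) - a ≡ + 2 * b
    collect = solve-∀

open IsFibonacci

isFibonacci-unique : ∀ {G H} → IsFibonacci G → IsFibonacci H →
  G (+ 0) ≡ H (+ 0) → G (+ 1) ≡ H (+ 1) → ∀ m → G m ≡ H m
isFibonacci-unique {G} {H} G-fib H-fib G0≡H0 G1≡H1 = λ where
    (+ n)    → proj₁ (upward n)
    -[1+ n ] → proj₁ (downward n)
  where
  forward : ∀ m → G m ≡ H m → G (sucℤ m) ≡ H (sucℤ m) → G (sucℤ (sucℤ m)) ≡ H (sucℤ (sucℤ m))
  forward m p q = trans (recurrence G-fib m) (trans (cong₂ _+_ q p) (sym (recurrence H-fib m)))
  backward : ∀ m → G (sucℤ m) ≡ H (sucℤ m) → G (sucℤ (sucℤ m)) ≡ H (sucℤ (sucℤ m)) → G m ≡ H m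
  backward m q r = trans (recurrence⁻ G-fib m) (trans (cong₂ _-_ r q) (sym (recurrence⁻ H-fib m)))
  upward : ∀ n → G (+ n) ≡ H (+ n) × G (+ suc n) ≡ H (+ suc n)
  upward zero    = G0≡H0 , G1≡H1
  upward (suc n) = let (p , q) = upward n in q , forward (+ n) p q
  downward : ∀ n → G -[1+ n ] ≡ H -[1+ n ] × G (sucℤ -[1+ n ]) ≡ H (sucℤ -[1+ n ])
  downward zero    = backward -[1+ 0 ] G0≡H0 G1≡H1 , G0≡H0
  downward (suc n) = let (p , q) = downward n in backward -[1+ suc n ] p q , p

isFibonacci-unique₂ : ∀ {Φ Ψ : ℤ → ℤ → ℤ} →
  (∀ b → IsFibonacci (λ a → Φ a b)) → (∀ a → IsFibonacci (Φ a)) →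
  (∀ b → IsFibonacci (λ a → Ψ a b)) → (∀ a → IsFibonacci (Ψ a)) →
  Φ (+ 0) (+ 0) ≡ Ψ (+ 0) (+ 0) → Φ (+ 0) (+ 1) ≡ Ψ (+ 0) (+ 1) →
  Φ (+ 1) (+ 0) ≡ Ψ (+ 1) (+ 0) → Φ (+ 1) (+ 1) ≡ Ψ (+ 1) (+ 1) →
  ∀ a b → Φ a b ≡ Ψ a b
isFibonacci-unique₂ Φ-fibˡ Φ-fibʳ Ψ-fibˡ Ψ-fibʳ e₀₀ e₀₁ e₁₀ e₁₁ a =
  isFibonacci-unique (Φ-fibʳ a) (Ψ-fibʳ a)
    (isFibonacci-unique (Φ-fibˡ (+ 0)) (Ψ-fibˡ (+ 0)) e₀₀ e₁₀ a)
    (isFibonacci-unique (Φ-fibˡ (+ 1)) (Ψ-fibˡ (+ 1)) e₀₁ e₁₁ a)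

isFibonacci-+ : ∀ {G H} → IsFibonacci G → IsFibonacci H → IsFibonacci (λ a → G a + H a)
isFibonacci-+ {G} {H} G-fib H-fib .recurrence m =
  trans (cong₂ _+_ (recurrence G-fib m) (recurrence H-fib m))
        (interchange (G (sucℤ m)) (G m) (H (sucℤ m)) (H m))

isFibonacci-*ˡ : ∀ {G} c → IsFibonacci G → IsFibonacci (λ a → c * G a)
isFibonacci-*ˡ {G} c G-fib .recurrence m =
  trans (cong (c *_) (recurrence G-fib m)) (ℤP.*-distribˡ-+ c (G (sucℤ m)) (G m))

isFibonacci-*ʳ : ∀ {G} c → IsFibonacci G → IsFibonacci (λ a → G a * c)
isFibonacci-*ʳ {G} c G-fib .recurrence m =
  trans (cong (_* c) (recurrence G-fib m)) (ℤP.*-distribʳ-+ c (G (sucℤ m)) (G m))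

isFibonacci-∘ : ∀ {G} → IsFibonacci G → ∀ f → (∀ m → f (sucℤ m) ≡ sucℤ (f m)) → IsFibonacci (G ∘ f)
isFibonacci-∘ {G} G-fib f f-suc .recurrence m = begin
  G (f (sucℤ (sucℤ m)))          ≡⟨ cong G (trans (f-suc (sucℤ m)) (cong sucℤ (f-suc m))) ⟩
  G (sucℤ (sucℤ (f m)))          ≡⟨ recurrence G-fib (f m) ⟩
  G (sucℤ (f m)) + G (f m)       ≡⟨ cong (λ i → G i + G (f m)) (f-suc m) ⟨
  G (f (sucℤ m)) + G (f m)       ∎

isFibonacci-reflect : ∀ {G} c → IsFibonacci G → IsFibonacci (λ b → sgn' b * G (c - b))
isFibonacci-reflect {G} c G-fib .recurrence b = begin
  sgn' (sucℤ (sucℤ b)) * G (c - sucℤ (sucℤ b))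
    ≡⟨ cong₂ _*_ (sgn'-suc-suc b) (recurrence⁻ G-fib (c - sucℤ (sucℤ b))) ⟩
  sgn' b * (G (sucℤ (sucℤ (c - sucℤ (sucℤ b)))) - G (sucℤ (c - sucℤ (sucℤ b))))
    ≡⟨ cong₂ (λ i j → sgn' b * (G i - G j)) (index₂ c b) (index₁ c b) ⟩
  sgn' b * (G (c - b) - G (c - sucℤ b))
    ≡⟨ regroup (sgn' b) (G (c - b)) (G (c - sucℤ b)) ⟩
  - sgn' b * G (c - sucℤ b) + sgn' b * G (c - b)
    ≡⟨ cong (λ σ → σ * G (c - sucℤ b) + sgn' b * G (c - b)) (sgn'-suc b) ⟨
  sgn' (sucℤ b) * G (c - sucℤ b) + sgn' b * G (c - b)
    ∎
  where
  index₂ : ∀ c b → + 1 + (+ 1 + (c - (+ 1 + (+ 1 + b)))) ≡ c - b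
  index₂ = solve-∀
  index₁ : ∀ c b → + 1 + (c - (+ 1 + (+ 1 + b))) ≡ c - (+ 1 + b)
  index₁ = solve-∀
  regroup : ∀ σ x y → σ * (x - y) ≡ - σ * y + σ * x
  regroup = solve-∀

alternating-recurrence : ∀ σ a b → σ * a ≡ - σ * (a + b) + - - σ * ((a + b) + a)
alternating-recurrence = solve-∀

F-isFibonacci : IsFibonacci F
F-isFibonacci .recurrence (+ n)              = refl
F-isFibonacci .recurrence -[1+ 0 ]           = refl
F-isFibonacci .recurrence -[1+ 1 ]           = refl
F-isFibonacci .recurrence -[1+ suc (suc n) ] =
  alternating-recurrence (sgn n) (+ fibℕ (suc n)) (+ fibℕ n)

L-isFibonacci : IsFibonacci L
L-isFibonacci .recurrence (+ n)              = refl
L-isFibonacci .recurrence -[1+ 0 ]           = refl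
L-isFibonacci .recurrence -[1+ 1 ]           = refl
L-isFibonacci .recurrence -[1+ suc (suc n) ] =
  alternating-recurrence (sgn (suc n)) (+ lucℕ (suc n)) (+ lucℕ n)

module _ {G} (G-fib : IsFibonacci G) (ε : ℤ) where

  productFormula-isFibonacciˡ : ∀ b → IsFibonacci (λ a → G (a + b) + ε * (sgn' b * G (a - b)))
  productFormula-isFibonacciˡ b = isFibonacci-+
    (isFibonacci-∘ G-fib (_+ b) (λ a → ℤP.+-assoc (+ 1) a b))
    (isFibonacci-*ˡ ε (isFibonacci-*ˡ (sgn' b)
      (isFibonacci-∘ G-fib (_- b) (λ a → ℤP.+-assoc (+ 1) a (- b)))))

  productFormula-isFibonacciʳ : ∀ a → IsFibonacci (λ b → G (a + b) + ε * (sgn' b * G (a - b)))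
  productFormula-isFibonacciʳ a = isFibonacci-+
    (isFibonacci-∘ G-fib (_+_ a) (λ b → shift a b))
    (isFibonacci-*ˡ ε (isFibonacci-reflect a G-fib))
    where
    shift : ∀ a b → a + (+ 1 + b) ≡ + 1 + (a + b)
    shift = solve-∀

-- Stated in the shape c * P a * Q b ≡ G (a + b) + ε * (sgn' b * G (a - b)) that
-- evenBinomialSum-product consumes, hence the factors 1ℤ.
FF-product : ∀ a b → + 5 * F a * F b ≡ L (a + b) + -1ℤ * (sgn' b * L (a - b))
FF-product = isFibonacci-unique₂
  (λ b → isFibonacci-*ʳ (F b) (isFibonacci-*ˡ (+ 5) F-isFibonacci))
  (λ a → isFibonacci-*ˡ (+ 5 * F a) F-isFibonacci)
  (productFormula-isFibonacciˡ L-isFibonacci -1ℤ)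
  (productFormula-isFibonacciʳ L-isFibonacci -1ℤ)
  refl refl refl refl

LF-product : ∀ a b → 1ℤ * L a * F b ≡ F (a + b) + -1ℤ * (sgn' b * F (a - b))
LF-product = isFibonacci-unique₂
  (λ b → isFibonacci-*ʳ (F b) (isFibonacci-*ˡ 1ℤ L-isFibonacci))
  (λ a → isFibonacci-*ˡ (1ℤ * L a) F-isFibonacci)
  (productFormula-isFibonacciˡ F-isFibonacci -1ℤ)
  (productFormula-isFibonacciʳ F-isFibonacci -1ℤ)
  refl refl refl refl

LL-product : ∀ a b → 1ℤ * L a * L b ≡ L (a + b) + 1ℤ * (sgn' b * L (a - b))
LL-product = isFibonacci-unique₂
  (λ b → isFibonacci-*ʳ (L b) (isFibonacci-*ˡ 1ℤ L-isFibonacci))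
  (λ a → isFibonacci-*ˡ (1ℤ * L a) L-isFibonacci)
  (productFormula-isFibonacciˡ L-isFibonacci 1ℤ)
  (productFormula-isFibonacciʳ L-isFibonacci 1ℤ)
  refl refl refl refl

-- The terms with j even, resp. odd, of Σ_j C(n,j) G (3j + x).
evenPart oddPart : ℕ → ℕ → (ℤ → ℤ) → ℤ → ℤ
evenPart N n G x = evenBinomialSum N n (λ k → G (+ (6 ℕ.* k) + x))
oddPart  N n G x = oddBinomialSum  N n (λ k → G (+ (6 ℕ.* k) + (+ 3 + x)))

6[1+k]+x : ∀ k x → + (6 ℕ.* suc k) + x ≡ + (6 ℕ.* k) + (+ 3 + (+ 3 + x))
6[1+k]+x k x = trans (cong (λ i → + i + x) (ℕP.*-suc 6 k)) (shuffle (+ (6 ℕ.* k)) x)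
  where
  shuffle : ∀ y x → (+ 6 + y) + x ≡ y + (+ 3 + (+ 3 + x))
  shuffle = solve-∀

2[1+n]+x : ∀ n x → + (2 ℕ.* suc n) + x ≡ sucℤ (sucℤ (+ (2 ℕ.* n) + x))
2[1+n]+x n x = trans (cong (λ i → + i + x) (ℕP.*-suc 2 n)) (shuffle (+ (2 ℕ.* n)) x)
  where
  shuffle : ∀ y x → (+ 2 + y) + x ≡ + 1 + (+ 1 + (y + x))
  shuffle = solve-∀

y+[3+x] : ∀ y x → y + (+ 3 + x) ≡ + 1 + (+ 1 + (+ 1 + (y + x)))
y+[3+x] = solve-∀

evenPart-zero : ∀ M G x → evenPart (suc M) 0 G x ≡ G (+ 0 + x)
evenPart-zero M G x = evenBinomialSum-zero M (λ k → G (+ (6 ℕ.* k) + x))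

oddPart-zero : ∀ N G x → oddPart N 0 G x ≡ + 0
oddPart-zero N G x = oddBinomialSum-zero N (λ k → G (+ (6 ℕ.* k) + (+ 3 + x)))

evenPart-suc : ∀ {N n} G x → suc n < 2 ℕ.* N →
  evenPart N (suc n) G x ≡ evenPart N n G x + oddPart N n G (+ 3 + x)
evenPart-suc {N} {n} G x 1+n<2N = trans (evenBinomialSum-suc {N} {n} _ 1+n<2N)
  (cong (_+_ (evenPart N n G x))
        (sumOver-cong (upTo N) (λ k → cong (λ i → + (n C suc (2 ℕ.* k)) * G i) (6[1+k]+x k x))))

oddPart-suc : ∀ {N n} G x → oddPart N (suc n) G x ≡ evenPart N n G (+ 3 + x) + oddPart N n G x
oddPart-suc {N} {n} G x = oddBinomialSum-suc {N} {n} _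

2ⁿ*[2*g] : ∀ n g → + (2 ℕ.^ n) * (+ 2 * g) ≡ + (2 ℕ.^ suc n) * g
2ⁿ*[2*g] n g = trans (regroup (+ (2 ℕ.^ n)) g) (cong (_* g) (sym (ℤP.pos-* 2 (2 ℕ.^ n))))
  where
  regroup : ∀ p g → p * (+ 2 * g) ≡ (+ 2 * p) * g
  regroup = solve-∀

module _ {G} (G-fib : IsFibonacci G) where

  evenPart+oddPart : ∀ {N} n → n < 2 ℕ.* N → ∀ x →
    evenPart N n G x + oddPart N n G x ≡ + (2 ℕ.^ n) * G (+ (2 ℕ.* n) + x)
  evenPart+oddPart {suc M} zero _ x = begin
    evenPart (suc M) 0 G x + oddPart (suc M) 0 G x
      ≡⟨ cong₂ _+_ (evenPart-zero M G x) (oddPart-zero (suc M) G x) ⟩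
    G (+ 0 + x) + + 0
      ≡⟨ ℤP.+-identityʳ _ ⟩
    G (+ 0 + x)
      ≡⟨ ℤP.*-identityˡ _ ⟨
    + 1 * G (+ 0 + x)
      ∎
  evenPart+oddPart {N} (suc n) 1+n<2N x = begin
    evenPart N (suc n) G x + oddPart N (suc n) G x
      ≡⟨ cong₂ _+_ (evenPart-suc {N} {n} G x 1+n<2N) (oddPart-suc {N} {n} G x) ⟩
    (E x + O x′) + (E x′ + O x)
      ≡⟨ regroup (E x) (O x′) (E x′) (O x) ⟩
    (E x + O x) + (E x′ + O x′)
      ≡⟨ cong₂ _+_ (evenPart+oddPart {N} n n<2N x) (evenPart+oddPart {N} n n<2N x′) ⟩
    2ⁿ * G y + 2ⁿ * G (+ (2 ℕ.* n) + x′)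
      ≡⟨ cong (λ i → 2ⁿ * G y + 2ⁿ * G i) (y+[3+x] (+ (2 ℕ.* n)) x) ⟩
    2ⁿ * G y + 2ⁿ * G (sucℤ (sucℤ (sucℤ y)))
      ≡⟨ ℤP.*-distribˡ-+ 2ⁿ (G y) _ ⟨
    2ⁿ * (G y + G (sucℤ (sucℤ (sucℤ y))))
      ≡⟨ cong (2ⁿ *_) (threeApart-sum G-fib y) ⟩
    2ⁿ * (+ 2 * G (sucℤ (sucℤ y)))
      ≡⟨ 2ⁿ*[2*g] n _ ⟩
    + (2 ℕ.^ suc n) * G (sucℤ (sucℤ y))
      ≡⟨ cong (λ i → + (2 ℕ.^ suc n) * G i) (2[1+n]+x n x) ⟨
    + (2 ℕ.^ suc n) * G (+ (2 ℕ.* suc n) + x)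
      ∎
    where
    E = λ z → evenPart N n G z
    O = λ z → oddPart N n G z
    x′ = + 3 + x
    y = + (2 ℕ.* n) + x
    2ⁿ = + (2 ℕ.^ n)
    n<2N = ℕP.<⇒≤ 1+n<2N
    regroup : ∀ a b c d → (a + b) + (c + d) ≡ (a + d) + (c + b)
    regroup = solve-∀

  evenPart-oddPart : ∀ {N} n → n < 2 ℕ.* N → ∀ x →
    evenPart N n G x - oddPart N n G x ≡ + (2 ℕ.^ n) * (sgn n * G (+ n + x))
  evenPart-oddPart {suc M} zero _ x = begin
    evenPart (suc M) 0 G x - oddPart (suc M) 0 G x
      ≡⟨ cong₂ _-_ (evenPart-zero M G x) (oddPart-zero (suc M) G x) ⟩
    G (+ 0 + x) - + 0
      ≡⟨ unit (G (+ 0 + x)) ⟩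
    + 1 * (+ 1 * G (+ 0 + x))
      ∎
    where
    unit : ∀ g → g - + 0 ≡ + 1 * (+ 1 * g)
    unit = solve-∀
  evenPart-oddPart {N} (suc n) 1+n<2N x = begin
    evenPart N (suc n) G x - oddPart N (suc n) G x
      ≡⟨ cong₂ _-_ (evenPart-suc {N} {n} G x 1+n<2N) (oddPart-suc {N} {n} G x) ⟩
    (E x + O x′) - (E x′ + O x)
      ≡⟨ regroup (E x) (O x′) (E x′) (O x) ⟩
    (E x - O x) - (E x′ - O x′)
      ≡⟨ cong₂ _-_ (evenPart-oddPart {N} n n<2N x) (evenPart-oddPart {N} n n<2N x′) ⟩
    2ⁿ * (σ * G y) - 2ⁿ * (σ * G (+ n + x′))
      ≡⟨ cong (λ i → 2ⁿ * (σ * G y) - 2ⁿ * (σ * G i)) (y+[3+x] (+ n) x) ⟩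
    2ⁿ * (σ * G y) - 2ⁿ * (σ * G (sucℤ (sucℤ (sucℤ y))))
      ≡⟨ factor 2ⁿ σ (G y) _ ⟩
    2ⁿ * (- σ * (G (sucℤ (sucℤ (sucℤ y))) - G y))
      ≡⟨ cong (λ d → 2ⁿ * (- σ * d)) (threeApart-difference G-fib y) ⟩
    2ⁿ * (- σ * (+ 2 * G (sucℤ y)))
      ≡⟨ cong (2ⁿ *_) (swap (- σ) (G (sucℤ y))) ⟩
    2ⁿ * (+ 2 * (- σ * G (sucℤ y)))
      ≡⟨ 2ⁿ*[2*g] n _ ⟩
    + (2 ℕ.^ suc n) * (- σ * G (sucℤ y))
      ≡⟨ cong (λ i → + (2 ℕ.^ suc n) * (- σ * G i)) (ℤP.+-assoc (+ 1) (+ n) x) ⟨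
    + (2 ℕ.^ suc n) * (sgn (suc n) * G (+ suc n + x))
      ∎
    where
    E = λ z → evenPart N n G z
    O = λ z → oddPart N n G z
    x′ = + 3 + x
    y = + n + x
    σ = sgn n
    2ⁿ = + (2 ℕ.^ n)
    n<2N = ℕP.<⇒≤ 1+n<2N
    regroup : ∀ a b c d → (a + b) - (c + d) ≡ (a - d) - (c - b)
    regroup = solve-∀
    factor : ∀ p σ a b → p * (σ * a) - p * (σ * b) ≡ p * (- σ * (b - a))
    factor = solve-∀
    swap : ∀ s g → s * (+ 2 * g) ≡ + 2 * (s * g)
    swap = solve-∀

  evenPart-closedForm : ∀ {N} n .{{_ : NonZero n}} → n < 2 ℕ.* N → ∀ x →
    evenPart N n G x ≡ + (2 ℕ.^ (n ∸ 1)) * (G (+ (2 ℕ.* n) + x) + sgn n * G (+ n + x))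
  evenPart-closedForm {N} n@(suc m) n<2N x = ℤP.*-cancelˡ-≡ (+ 2) _ _ (begin
    + 2 * evenPart N n G x
      ≡⟨ halves (evenPart N n G x) (oddPart N n G x) ⟩
    (evenPart N n G x + oddPart N n G x) + (evenPart N n G x - oddPart N n G x)
      ≡⟨ cong₂ _+_ (evenPart+oddPart {N} n n<2N x) (evenPart-oddPart {N} n n<2N x) ⟩
    + (2 ℕ.^ n) * G (+ (2 ℕ.* n) + x) + + (2 ℕ.^ n) * (sgn n * G (+ n + x))
      ≡⟨ ℤP.*-distribˡ-+ (+ (2 ℕ.^ n)) _ _ ⟨
    + (2 ℕ.^ n) * X
      ≡⟨ cong (_* X) (ℤP.pos-* 2 (2 ℕ.^ m)) ⟩
    + 2 * + (2 ℕ.^ m) * X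
      ≡⟨ ℤP.*-assoc (+ 2) (+ (2 ℕ.^ m)) X ⟩
    + 2 * (+ (2 ℕ.^ m) * X)
      ∎)
    where
    X = G (+ (2 ℕ.* n) + x) + sgn n * G (+ n + x)
    halves : ∀ e o → + 2 * e ≡ (e + o) + (e - o)
    halves = solve-∀

n<2*[n/2+1] : ∀ n → n < 2 ℕ.* (n / 2 ℕ.+ 1)
n<2*[n/2+1] n = subst (_< 2 ℕ.* (n / 2 ℕ.+ 1)) (sym (m≡m%n+[m/n]*n n 2))
  (ℕP.<-≤-trans (ℕP.+-monoˡ-< (n / 2 ℕ.* 2) (m%n<n n 2)) (ℕP.≤-reflexive 2+q*2≡2*[q+1]))
  where
  2+q*2≡2*[q+1] : 2 ℕ.+ n / 2 ℕ.* 2 ≡ 2 ℕ.* (n / 2 ℕ.+ 1)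
  2+q*2≡2*[q+1] = trans (ℕP.*-comm (suc (n / 2)) 2) (cong (2 ℕ.*_) (ℕP.+-comm 1 (n / 2)))

productTerm : ∀ {P Q G : ℤ → ℤ} c ε →
  (∀ a b → c * P a * Q b ≡ G (a + b) + ε * (sgn' b * G (a - b))) →
  ∀ x k r s → c * (x * P (+ (3 ℕ.* k) + r) * Q (+ (3 ℕ.* k) + s))
              ≡ x * G (+ (6 ℕ.* k) + (r + s)) + ε * (sgn' s * G (r - s)) * (x * sgn k)
productTerm {P} {Q} {G} c ε product x k r s = begin
  c * (x * P (t + r) * Q (t + s))
    ≡⟨ pull c x (P (t + r)) (Q (t + s)) ⟩
  x * (c * P (t + r) * Q (t + s))
    ≡⟨ cong (x *_) (product (t + r) (t + s)) ⟩
  x * (G ((t + r) + (t + s)) + ε * (sgn' (t + s) * G ((t + r) - (t + s))))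
    ≡⟨ cong₂ (λ i j → x * (G i + ε * (sgn' (t + s) * G j))) sum-index (cancel t r s) ⟩
  x * (G (+ (6 ℕ.* k) + (r + s)) + ε * (sgn' (t + s) * G (r - s)))
    ≡⟨ cong (λ σ → x * (G (+ (6 ℕ.* k) + (r + s)) + ε * (σ * G (r - s)))) sign ⟩
  x * (G (+ (6 ℕ.* k) + (r + s)) + ε * (sgn k * sgn' s * G (r - s)))
    ≡⟨ distribute x _ ε (sgn k) (sgn' s) (G (r - s)) ⟩
  x * G (+ (6 ℕ.* k) + (r + s)) + ε * (sgn' s * G (r - s)) * (x * sgn k)
    ∎
  where
  t = + (3 ℕ.* k)
  pull : ∀ c x p q → c * (x * p * q) ≡ x * (c * p * q)
  pull = solve-∀
  cancel : ∀ t r s → (t + r) - (t + s) ≡ r - s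
  cancel = solve-∀
  distribute : ∀ x g ε σₖ σₛ h → x * (g + ε * (σₖ * σₛ * h)) ≡ x * g + ε * (σₛ * h) * (x * σₖ)
  distribute = solve-∀
  sum-index : (t + r) + (t + s) ≡ + (6 ℕ.* k) + (r + s)
  sum-index = begin
    (t + r) + (t + s)        ≡⟨ interchange t r t s ⟩
    (t + t) + (r + s)        ≡⟨ cong (_+ (r + s)) (ℤP.pos-+ (3 ℕ.* k) (3 ℕ.* k)) ⟨
    + (3 ℕ.* k ℕ.+ 3 ℕ.* k) + (r + s)  ≡⟨ cong (λ i → + i + (r + s)) (ℕP.*-distribʳ-+ k 3 3) ⟨
    + (6 ℕ.* k) + (r + s)    ∎
  sign : sgn' (t + s) ≡ sgn k * sgn' s
  sign = trans (sgn'-+ (3 ℕ.* k) s) (cong (_* sgn' s) (sgn-3* k))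

evenBinomialSum-product : ∀ {P Q G : ℤ → ℤ} → IsFibonacci G → ∀ c ε →
  (∀ a b → c * P a * Q b ≡ G (a + b) + ε * (sgn' b * G (a - b))) →
  ∀ n .{{_ : NonZero n}} r s →
  c * Σ< (n / 2 ℕ.+ 1) (λ k → + (n C (2 ℕ.* k)) * P (+ (3 ℕ.* k) + r) * Q (+ (3 ℕ.* k) + s))
    ≡ + (2 ℕ.^ (n ∸ 1)) * (G (+ (2 ℕ.* n) + r + s) + sgn n * G (+ n + r + s))
      + ε * (sgn' s * sqrt2ⁿcos n * G (r - s))
evenBinomialSum-product {P} {Q} {G} G-fib c ε product n r s = begin
  c * Σ< N term
    ≡⟨ sumOver-*ˡ (upTo N) c term ⟨
  Σ< N (λ k → c * term k)
    ≡⟨ sumOver-cong (upTo N) (λ k → productTerm {P} {Q} {G} c ε product (binom k) k r s) ⟩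
  Σ< N (λ k → binom k * G (+ (6 ℕ.* k) + (r + s)) + κ * (binom k * sgn k))
    ≡⟨ sumOver-+ (upTo N) (λ k → binom k * G (+ (6 ℕ.* k) + (r + s)))
                          (λ k → κ * (binom k * sgn k)) ⟩
  evenPart N n G (r + s) + Σ< N (λ k → κ * (binom k * sgn k))
    ≡⟨ cong (_+_ (evenPart N n G (r + s))) (sumOver-*ˡ (upTo N) κ (λ k → binom k * sgn k)) ⟩
  evenPart N n G (r + s) + κ * evenBinomialSum N n sgn
    ≡⟨ cong₂ (λ e o → e + κ * o) (evenPart-closedForm G-fib {N} n n<2N (r + s))
                                 (cong proj₁ (binomialSums-sgn {N} n n<2N)) ⟩
  2ⁿ⁻¹ * (G (+ (2 ℕ.* n) + (r + s)) + sgn n * G (+ n + (r + s))) + κ * sqrt2ⁿcos n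
    ≡⟨ cong₂ (λ i j → 2ⁿ⁻¹ * (G i + sgn n * G j) + κ * sqrt2ⁿcos n)
             (ℤP.+-assoc (+ (2 ℕ.* n)) r s) (ℤP.+-assoc (+ n) r s) ⟨
  leading + κ * sqrt2ⁿcos n
    ≡⟨ cong (_+_ leading) (reorder ε (sgn' s) (G (r - s)) (sqrt2ⁿcos n)) ⟩
  leading + ε * (sgn' s * sqrt2ⁿcos n * G (r - s))
    ∎
  where
  N = n / 2 ℕ.+ 1
  n<2N = n<2*[n/2+1] n
  2ⁿ⁻¹ = + (2 ℕ.^ (n ∸ 1))
  leading = 2ⁿ⁻¹ * (G (+ (2 ℕ.* n) + r + s) + sgn n * G (+ n + r + s))
  κ = ε * (sgn' s * G (r - s))
  binom : ℕ → ℤ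
  binom k = + (n C (2 ℕ.* k))
  term : ℕ → ℤ
  term k = binom k * P (+ (3 ℕ.* k) + r) * Q (+ (3 ℕ.* k) + s)
  reorder : ∀ ε σ g c → ε * (σ * g) * c ≡ ε * (σ * c * g)
  reorder = solve-∀

theorem28 : (n : ℕ) → .{{_ : NonZero n}} → (r s : ℤ) →
    ((+ 5) * Σ< (n / 2 ℕ.+ 1) (λ k → + (n C (2 ℕ.* k)) * F (+ (3 ℕ.* k) + r) * F (+ (3 ℕ.* k) + s))
      ≡ (+ (2 ℕ.^ (n ∸ 1))) * (L (+ (2 ℕ.* n) + r + s) + sgn n * L (+ n + r + s))
        - sgn' s * sqrt2ⁿcos n * L (r - s))
    × (Σ< (n / 2 ℕ.+ 1) (λ k → + (n C (2 ℕ.* k)) * L (+ (3 ℕ.* k) + r) * F (+ (3 ℕ.* k) + s))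
      ≡ (+ (2 ℕ.^ (n ∸ 1))) * (F (+ (2 ℕ.* n) + r + s) + sgn n * F (+ n + r + s))
        - sgn' s * sqrt2ⁿcos n * F (r - s))
    × (Σ< (n / 2 ℕ.+ 1) (λ k → + (n C (2 ℕ.* k)) * L (+ (3 ℕ.* k) + r) * L (+ (3 ℕ.* k) + s))
      ≡ (+ (2 ℕ.^ (n ∸ 1))) * (L (+ (2 ℕ.* n) + r + s) + sgn n * L (+ n + r + s))
        + sgn' s * sqrt2ⁿcos n * L (r - s))
theorem28 n r s =
    trans (evenBinomialSum-product {F} {F} L-isFibonacci (+ 5) -1ℤ FF-product n r s)
          (cong (_+_ (leading L)) (ℤP.-1*i≡-i (correction L)))
  , trans (sym (ℤP.*-identityˡ _))
      (trans (evenBinomialSum-product {L} {F} F-isFibonacci 1ℤ -1ℤ LF-product n r s)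
             (cong (_+_ (leading F)) (ℤP.-1*i≡-i (correction F))))
  , trans (sym (ℤP.*-identityˡ _))
      (trans (evenBinomialSum-product {L} {L} L-isFibonacci 1ℤ 1ℤ LL-product n r s)
             (cong (_+_ (leading L)) (ℤP.*-identityˡ (correction L))))
  where
  leading correction : (ℤ → ℤ) → ℤ
  leading G = + (2 ℕ.^ (n ∸ 1)) * (G (+ (2 ℕ.* n) + r + s) + sgn n * G (+ n + r + s))
  correction G = sgn' s * sqrt2ⁿcos n * G (r - s)
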